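{- The equations $p=\top$ and $\neg p=\top$ each have finite satisfiability gap $\frac12$ in the class of Heyting algebras: for every finite Heyting algebra $H$, each of $\mathrm{ds}_H(p=\top)$ and $\mathrm{ds}_H(\neg p=\top)$ is either $1$ or at most $\frac12$.
   Context: $\neg p$ abbreviates $p\to\bot$. For a finite Heyting algebra $H$ and an equation $\varphi(p)$, $\mathrm{ds}_H(\varphi)=|\{a\in H : H\models\varphi(a)\}|/|H|$. A formula has finite satisfiability gap $\varepsilon$ if for every finite model $H$, either $\mathrm{ds}_H=1$ or $\mathrm{ds}_H\le 1-\varepsilon$. -}

module Defs where

open import Level using (Level)
open import Data.Nat using (ℕ; zero; suc; _+_)
open import Data.Fin using (Fin; zero; suc)
import Data.Fin.Properties as FinP
open import Relation.Nullary using (Dec; yes; no)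
open import Relation.Nullary.Decidable using (map′)
open import Relation.Unary using (Pred; Decidable)
open import Relation.Binary.PropositionalEquality using (_≡_)
import Relation.Binary.PropositionalEquality as ≡
open import Relation.Binary.Lattice using (HeytingAlgebra)
open import Function.Bundles using (Bijection)

count : ∀ {p} (n : ℕ) {P : Pred (Fin n) p} → Decidable P → ℕ
count zero    dec = 0
count (suc n) dec with dec zero
... | yes _ = suc (count n (λ i → dec (suc i)))
... | no  _ = count n (λ i → dec (suc i))

record FiniteHeytingAlgebra (c ℓ₁ ℓ₂ : Level) : Set (Level.suc (c Level.⊔ ℓ₁ Level.⊔ ℓ₂)) where
  field
    heyting : HeytingAlgebra c ℓ₁ ℓ₂
    size    : ℕ
  open HeytingAlgebra heyting public
  field
    enum : Bijection setoid (≡.setoid (Fin size))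

  open Bijection enum public using (to; to⁻; injective; strictlySurjective)
    renaming (cong to to-cong)

  ¬ₕ_ : Carrier → Carrier
  ¬ₕ x = x ⇨ ⊥

  elem : Fin size → Carrier
  elem = to⁻

  _≈?_ : (x y : Carrier) → Dec (x ≈ y)
  x ≈? y = map′ injective to-cong (to x FinP.≟ to y)

  #sat : (Carrier → Carrier) → ℕ
  #sat φ = count size {P = λ i → φ (elem i) ≈ ⊤} (λ i → φ (elem i) ≈? ⊤)

-- In any Heyting algebra  a = ⊤  holds only for a = ⊤, and  ¬ a = ⊤  only for
-- a = ⊥  (since  x ⇨ y ≈ ⊤  iff  x ≤ y).  So each equation has exactly one
-- solution in a finite H, i.e. ds_H = 1/|H|, which is 1 when |H| = 1 and at
-- most 1/2 otherwise.
module Submission where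

open import Defs
open FiniteHeytingAlgebra using (#sat; size; ¬ₕ_)
open import Level using (Level)
open import Data.Nat using (zero; suc; _*_; _≤_; s≤s; z≤n)
open import Data.Fin using (Fin; zero; suc)
open import Data.Fin.Properties using (suc-injective)
open import Data.Product using (_×_; _,_; proj₂)
open import Data.Sum using (_⊎_; inj₁; inj₂)
open import Data.Empty using (⊥-elim)
open import Function using (case_of_)
open import Relation.Nullary using (yes; no; ¬_)
open import Relation.Unary using (Pred; Decidable)
open import Relation.Binary.PropositionalEquality using (_≡_; refl; cong; sym; trans)
open import Relation.Binary.Lattice using (HeytingAlgebra)
import Relation.Binary.Lattice.Properties.HeytingAlgebra as HeytingProperties

count-none : ∀ {p} n {P : Pred (Fin n) p} (P? : Decidable P) →
  (∀ i → ¬ P i) → count n P? ≡ 0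
count-none zero    P? none = refl
count-none (suc n) P? none with P? zero
... | yes P0 = ⊥-elim (none zero P0)
... | no  _  = count-none n (λ i → P? (suc i)) (λ i → none (suc i))

count-unique : ∀ {p} n {P : Pred (Fin n) p} (P? : Decidable P) (k : Fin n) →
  P k → (∀ i → P i → i ≡ k) → count n P? ≡ 1
count-unique (suc n) P? zero Pk unique with P? zero
... | yes _  = cong suc (count-none n (λ i → P? (suc i)) (λ i Pi → case unique (suc i) Pi of λ ()))
... | no ¬P0 = ⊥-elim (¬P0 Pk)
count-unique (suc n) P? (suc k) Pk unique with P? zero
... | yes P0 = case unique zero P0 of λ ()
... | no _   = count-unique n (λ i → P? (suc i)) k Pk (λ i Pi → suc-injective (unique (suc i) Pi))

one-or-half : ∀ {n} → Fin n → 1 ≡ n ⊎ 2 * 1 ≤ n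
one-or-half {suc zero}    _ = inj₁ refl
one-or-half {suc (suc n)} _ = inj₂ (s≤s (s≤s z≤n))

module _ {c ℓ₁ ℓ₂} (H : HeytingAlgebra c ℓ₁ ℓ₂) where
  open HeytingAlgebra H
    renaming (_≤_ to _≼_; trans to ≼-trans; refl to ≼-refl)
  open HeytingProperties H using (⇨-eval)

  ⇨≈⊤⇒≤ : ∀ {x y} → x ⇨ y ≈ ⊤ → x ≼ y
  ⇨≈⊤⇒≤ {x} x⇨y≈⊤ =
    ≼-trans (∧-greatest (≼-trans (maximum x) (reflexive (Eq.sym x⇨y≈⊤))) ≼-refl) ⇨-eval

  ≤⇒⇨≈⊤ : ∀ {x y} → x ≼ y → x ⇨ y ≈ ⊤
  ≤⇒⇨≈⊤ {x} x≼y = antisym (maximum _) (transpose-⇨ (≼-trans (x∧y≤y ⊤ x) x≼y))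

  ¬≈⊤⇒≈⊥ : ∀ {x} → x ⇨ ⊥ ≈ ⊤ → x ≈ ⊥
  ¬≈⊤⇒≈⊥ {x} ¬x≈⊤ = antisym (⇨≈⊤⇒≤ ¬x≈⊤) (minimum x)

  ≈⊥⇒¬≈⊤ : ∀ {x} → x ≈ ⊥ → x ⇨ ⊥ ≈ ⊤
  ≈⊥⇒¬≈⊤ x≈⊥ = ≤⇒⇨≈⊤ (reflexive x≈⊥)

module _ {c ℓ₁ ℓ₂} (H : FiniteHeytingAlgebra c ℓ₁ ℓ₂) where
  open FiniteHeytingAlgebra H
    using (Carrier; _≈_; ⊤; to; elem; to-cong; injective; strictlySurjective)

  #sat-unique : (φ : Carrier → Carrier) (a : Carrier) →
    (∀ x → φ x ≈ ⊤ → x ≈ a) → (∀ x → x ≈ a → φ x ≈ ⊤) → #sat H φ ≡ 1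
  #sat-unique φ a only-a a-sat =
    count-unique (size H) _ (to a)
      (a-sat _ (injective (to-elem (to a))))
      (λ i φi≈⊤ → trans (sym (to-elem i)) (to-cong (only-a _ φi≈⊤)))
    where
    to-elem : ∀ i → to (elem i) ≡ i
    to-elem i = proj₂ (strictlySurjective i)

  #sat≡1⇒ds≡1⊎ds≤½ : ∀ φ → #sat H φ ≡ 1 → (#sat H φ ≡ size H) ⊎ (2 * #sat H φ ≤ size H)
  #sat≡1⇒ds≡1⊎ds≤½ φ #sat≡1 rewrite #sat≡1 = one-or-half (to ⊤)

proposition2p2 : ∀ {c ℓ₁ ℓ₂ : Level} (H : FiniteHeytingAlgebra c ℓ₁ ℓ₂) →
    ((#sat H (λ p → p) ≡ size H) ⊎ (2 * #sat H (λ p → p) ≤ size H))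
    × ((#sat H (λ p → ¬ₕ_ H p) ≡ size H) ⊎ (2 * #sat H (λ p → ¬ₕ_ H p) ≤ size H))
proposition2p2 H =
    #sat≡1⇒ds≡1⊎ds≤½ H (λ p → p) (#sat-unique H (λ p → p) ⊤ (λ _ p≈⊤ → p≈⊤) (λ _ p≈⊤ → p≈⊤))
  , #sat≡1⇒ds≡1⊎ds≤½ H (¬ₕ_ H) (#sat-unique H (¬ₕ_ H) ⊥ (λ _ → ¬≈⊤⇒≈⊥ heyting) (λ _ → ≈⊥⇒¬≈⊤ heyting))
  where open FiniteHeytingAlgebra H using (heyting; ⊤; ⊥)
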